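{- Let $F$ be a finite family of intervals and let $s$ be a minimal bad interval for $F$. Then for every integer $x$, $N_x(F\downarrow s)=N_x F-N_x s$, where $N_x s$ is $1$ if $x\in s$ and $0$ otherwise.
   Context: For integers $a<b$, $[a,b)=\{x\in\mathbb{Z}: a\le x<b\}$; an interval is a nonempty set of this form. A family is a finite set of intervals. For a set $s$, $F|s=\{f\in F: f\subseteq s\}$. For an integer $x$, $N_x F$ is the number of members of $F$ containing $x$. An interval $s$ is good for $F$ if $N_x(F|s)\le 1$ for some $x\in s$, and bad otherwise; a minimal bad interval is a bad interval containing no other bad interval. Given an interval $s$, let $[a_1,b_1),\dots,[a_k,b_k)$ be the inclusion-maximal members of $F|s$, ordered so that $a_1<\dots<a_k$ (then $b_1<\dots<b_k$). If $a_{j+1}<b_j$ for $1\le j<k$, define $F\downarrow s=(F\setminus\{[a_1,b_1),\dots,[a_k,b_k)\})\cup\{[a_2,b_1),\dots,[a_k,b_{k-1})\}$; this condition holds whenever $s$ is a minimal bad interval for $F$, so $F\downarrow s$ is then defined. -}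

module Defs where

open import Data.Bool using (Bool; true; false; _∧_; _∨_; not; if_then_else_; T)
open import Data.Nat using (ℕ) renaming (_≤_ to _≤ℕ_; _+_ to _+ℕ_)
open import Data.Integer using (ℤ; _≤_; _<_; _≤ᵇ_; _≟_)
open import Data.Product using (_×_; _,_; Σ; ∃)
open import Data.List using (List; []; _∷_; filterᵇ; length; zipWith; drop; _++_; deduplicate)
open import Data.List.Relation.Unary.All using (All)
open import Data.List.Relation.Unary.Unique.Propositional using (Unique)
open import Relation.Binary.PropositionalEquality using (_≡_; _≢_)
open import Relation.Nullary using (¬_)
open import Relation.Nullary.Decidable using (⌊_⌋)
open import Data.Product.Properties using (≡-dec)

-- A pair (a , b) stands for the integer interval [a,b) = {x ∈ ℤ | a ≤ x < b}.
Ival : Set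
Ival = ℤ × ℤ

IsInterval : Ival → Set
IsInterval (a , b) = a < b

_∈ᵢ_ : ℤ → Ival → Set
x ∈ᵢ (a , b) = (a ≤ x) × (x < b)

_∈ᵇ_ : ℤ → Ival → Bool
x ∈ᵇ (a , b) = (a ≤ᵇ x) ∧ not (b ≤ᵇ x)

-- Inclusion [a,b) ⊆ [c,d); for nonempty intervals this is exactly
-- inclusion of the underlying sets of integers.
_⊆ᵢ_ : Ival → Ival → Set
(a , b) ⊆ᵢ (c , d) = (c ≤ a) × (b ≤ d)

_⊆ᵇ_ : Ival → Ival → Bool
(a , b) ⊆ᵇ (c , d) = (c ≤ᵇ a) ∧ (b ≤ᵇ d)

_==ᵢ_ : Ival → Ival → Bool
I ==ᵢ J = ⌊ ≡-dec _≟_ _≟_ I J ⌋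

IsFamily : List Ival → Set
IsFamily F = All IsInterval F × Unique F

restrict : List Ival → Ival → List Ival
restrict F s = filterᵇ (λ f → f ⊆ᵇ s) F

N : ℤ → List Ival → ℕ
N x F = length (filterᵇ (λ f → x ∈ᵇ f) F)

Nᵢ : ℤ → Ival → ℕ
Nᵢ x s = if x ∈ᵇ s then 1 else 0

Good : List Ival → Ival → Set
Good F s = ∃ λ x → (x ∈ᵢ s) × (N x (restrict F s) ≤ℕ 1)

Bad : List Ival → Ival → Set
Bad F s = ¬ Good F s

MinimalBad : List Ival → Ival → Set
MinimalBad F s = IsInterval s × Bad F s ×
  (∀ t → IsInterval t → t ⊆ᵢ s → t ≢ s → ¬ Bad F t)

allᵇ : (Ival → Bool) → List Ival → Bool
allᵇ p [] = true
allᵇ p (x ∷ xs) = p x ∧ allᵇ p xs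

isMaximalIn : List Ival → Ival → Bool
isMaximalIn G I = allᵇ (λ J → not (I ⊆ᵇ J) ∨ (J ==ᵢ I)) G

maximals : List Ival → List Ival
maximals G = filterᵇ (isMaximalIn G) G

insertByLeft : Ival → List Ival → List Ival
insertByLeft I [] = I ∷ []
insertByLeft (a , b) ((c , d) ∷ xs) =
  if a ≤ᵇ c then (a , b) ∷ (c , d) ∷ xs else (c , d) ∷ insertByLeft (a , b) xs

sortByLeft : List Ival → List Ival
sortByLeft [] = []
sortByLeft (I ∷ xs) = insertByLeft I (sortByLeft xs)

maxList : List Ival → Ival → List Ival
maxList F s = sortByLeft (maximals (restrict F s))

consecutive : List Ival → List (Ival × Ival)
consecutive ms = zipWith _,_ ms (drop 1 ms)

Overlapping : List Ival → Ival → Set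
Overlapping F s =
  All (λ { ((a , b) , (a' , b')) → a' < b }) (consecutive (maxList F s))

newIntervals : List Ival → Ival → List Ival
newIntervals F s = zipWith (λ { (a , b) (a' , b') → (a' , b) }) ms (drop 1 ms)
  where ms = maxList F s

-- F ↓ s = (F \ {maximal members of F|s}) ∪ {[a_2,b_1), …, [a_k,b_{k-1})}
-- (set union, realised by removing duplicates)
_↓_ : List Ival → Ival → List Ival
F ↓ s = deduplicate (≡-dec _≟_ _≟_)
  (filterᵇ (λ f → not (isMaximalIn (restrict F s) f ∧ (f ⊆ᵇ s))) F ++ newIntervals F s)

-- The maximal members [a₁,b₁),…,[a_k,b_k) of F|s, sorted by left endpoint, cover s because s
-- is bad, and maximality forces a₁ < ⋯ < a_k and b₁ < ⋯ < b_k.  The prefix [min s, b_j) of s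
-- is a proper subinterval, hence not bad.  Left of a_{j+1} every member of F|s through a point
-- already lies in the prefix, so the prefix could only be good at a point of [a_{j+1}, b_j):
-- thus a_{j+1} < b_j, and [a_{j+1}, b_j) ∉ F, as it would be a second interval of the prefix
-- through that point.  So F ↓ s just trades the maximal intervals for the new ones, and the
-- count follows from the identity [a,b) + [a',B) = [a',b) + [a,B) of indicators for
-- a ≤ a' ≤ b ≤ B, which telescopes along the staircase to
-- Σ_j [a_j,b_j) = Σ_j [a_{j+1},b_j) + [a₁,b_k), with [a₁,b_k) = s.
module Submission where

open import Defs
open import Data.Bool using (Bool; true; false; not; _∧_; _∨_; T; if_then_else_)
open import Data.Empty using (⊥-elim)
open import Data.Integer using (ℤ; _≤_; _<_; _≤ᵇ_; _≟_)
open import Data.Integer.Properties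
  using (≤ᵇ⇒≤; ≤⇒≤ᵇ; ≤-refl; ≤-trans; ≤-antisym; <⇒≤; <⇒≱; ≰⇒>; ≮⇒≥; ≤-<-trans; <-≤-trans;
         <-trans; <-irrefl; _≤?_; _<?_)
open import Data.List using (List; []; _∷_; length; filter; filterᵇ; zipWith; drop; _++_; deduplicate)
open import Data.List.Properties using (length-++; filter-++; filter-all)
open import Data.List.Membership.Propositional using (_∈_; _∉_; lose)
open import Data.List.Membership.Propositional.Properties using (∈-filter⁺; ∈-filter⁻)
open import Data.List.Relation.Unary.Any using (Any; here; there)
open import Data.List.Relation.Unary.Any.Properties using (¬Any[])
open import Data.List.Relation.Unary.All as All using (All; []; _∷_)
open import Data.List.Relation.Unary.AllPairs using (AllPairs; []; _∷_)
open import Data.List.Relation.Unary.Linked as Linked using (Linked; []; [-]; _∷_)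
open import Data.List.Relation.Unary.Linked.Properties using (AllPairs⇒Linked)
open import Data.List.Relation.Unary.Unique.Propositional using (Unique)
import Data.List.Relation.Unary.Unique.Propositional.Properties as Unique
open import Data.List.Relation.Binary.Permutation.Propositional
  using (_↭_; prep; swap; ↭-refl; ↭-sym; ↭-trans; ↭⇒↭ₛ′)
open import Data.List.Relation.Binary.Permutation.Propositional.Properties
  using (All-resp-↭; ∈-resp-↭; ↭-length; filter-↭)
import Data.List.Relation.Binary.Permutation.Setoid.Properties as Permutationₛ
open import Data.Nat using (ℕ; _+_; z≤n; s≤s) renaming (_≤_ to _≤ℕ_)
import Data.Nat.Properties as ℕ
open import Algebra.Properties.CommutativeSemigroup ℕ.+-commutativeSemigroup
  using (x∙yz≈y∙xz; interchange)
open import Data.Product using (_×_; _,_; proj₁; proj₂; ∃-syntax; uncurry)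
open import Data.Product.Properties using (≡-dec)
open import Data.Sum using (_⊎_; inj₁; inj₂)
open import Function using (_∘_)
open import Relation.Binary.Definitions
  using (Reflexive; Transitive; Antisymmetric; Decidable; DecidableEquality)
open import Relation.Binary.PropositionalEquality
open import Relation.Nullary using (¬_; Dec; yes; no; does; proof; ¬?; map′; _×-dec_; _→-dec_)
open import Relation.Nullary.Decidable using (T?; isYes≗does)
open import Relation.Nullary.Reflects using (Reflects; ofʸ; ofⁿ; det)

module _ {A : Set} where

  deduplicate-unique : (_≟ₐ_ : DecidableEquality A) {xs : List A} →
                       Unique xs → deduplicate _≟ₐ_ xs ≡ xs
  deduplicate-unique _≟ₐ_ [] = refl
  deduplicate-unique _≟ₐ_ {x ∷ xs} (x∉xs ∷ u) =
    cong (x ∷_) (trans (cong (filter (¬? ∘ (x ≟ₐ_))) (deduplicate-unique _≟ₐ_ u))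
                       (filter-all (¬? ∘ (x ≟ₐ_)) x∉xs))

  Unique-resp-↭ : ∀ {xs ys : List A} → xs ↭ ys → Unique xs → Unique ys
  Unique-resp-↭ xs↭ys = Permutationₛ.Unique-resp-↭ (setoid A) (↭⇒↭ₛ′ isEquivalence xs↭ys)

  nonempty⇒∈ : ∀ {xs : List A} → 1 ≤ℕ length xs → ∃[ x ] x ∈ xs
  nonempty⇒∈ {x ∷ _} _ = x , here refl

  distinct∈⇒2≤length : ∀ {x y : A} {xs} → x ∈ xs → y ∈ xs → x ≢ y → 2 ≤ℕ length xs
  distinct∈⇒2≤length (here refl) (here refl) x≢y = ⊥-elim (x≢y refl)
  distinct∈⇒2≤length (here refl) (there {xs = _ ∷ _} _) _ = s≤s (s≤s z≤n)
  distinct∈⇒2≤length (there {xs = _ ∷ _} _) _ _ = s≤s (s≤s z≤n)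

  length-filter-mono : (r p q : A → Bool) (xs : List A) →
                       (∀ {y} → y ∈ xs → T (p y) → T (r y) → T (q y)) →
                       length (filterᵇ r (filterᵇ p xs)) ≤ℕ length (filterᵇ r (filterᵇ q xs))
  length-filter-mono r p q [] _ = z≤n
  length-filter-mono r p q (y ∷ xs) h with p y in py
  ... | false with q y
  ...   | false = length-filter-mono r p q xs (h ∘ there)
  ...   | true with r y
  ...     | true = ℕ.m≤n⇒m≤1+n (length-filter-mono r p q xs (h ∘ there))
  ...     | false = length-filter-mono r p q xs (h ∘ there)
  length-filter-mono r p q (y ∷ xs) h | true with q y in qy
  ... | true with r y
  ...   | true = s≤s (length-filter-mono r p q xs (h ∘ there))
  ...   | false = length-filter-mono r p q xs (h ∘ there)
  length-filter-mono r p q (y ∷ xs) h | true | false with r y in ry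
  ...   | true = ⊥-elim (subst T qy (h (here refl) (subst T (sym py) _) (subst T (sym ry) _)))
  ...   | false = length-filter-mono r p q xs (h ∘ there)

  Linked⇒All-zipWith : ∀ {B : Set} {P : B → Set} (f : A → A → B) {xs} →
                       Linked (λ y z → P (f y z)) xs → All P (zipWith f xs (drop 1 xs))
  Linked⇒All-zipWith f [] = []
  Linked⇒All-zipWith f [-] = []
  Linked⇒All-zipWith f (p ∷ ps) = p ∷ Linked⇒All-zipWith f ps

  Adjacent : (A → A → Set) → List A → A → A → Set
  Adjacent R xs y z = y ∈ xs × z ∈ xs × All (λ m → R m y ⊎ R z m) xs

  AllPairs⇒Linked-adjacent : ∀ {R : A → A → Set} → Reflexive R →
                             ∀ {xs} → AllPairs R xs → Linked (Adjacent R xs) xs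
  AllPairs⇒Linked-adjacent R-refl [] = []
  AllPairs⇒Linked-adjacent R-refl ([] ∷ []) = [-]
  AllPairs⇒Linked-adjacent R-refl (Rx ∷ rest@(Ry ∷ _)) =
    (here refl , there (here refl) , inj₁ R-refl ∷ inj₂ R-refl ∷ All.map inj₂ Ry)
    ∷ Linked.map extend (AllPairs⇒Linked-adjacent R-refl rest)
    where
    extend : ∀ {y z} → Adjacent _ _ y z → Adjacent _ _ y z
    extend (y∈ , z∈ , gaps) = there y∈ , there z∈ , inj₁ (All.lookup Rx y∈) ∷ gaps

  Maximal : (A → A → Set) → List A → A → Set
  Maximal _≼_ xs m = All (λ y → m ≼ y → y ≡ m) xs

  module _ {_≼_ : A → A → Set} (≼-refl : Reflexive _≼_) (≼-trans : Transitive _≼_)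
           (≼-antisym : Antisymmetric _≡_ _≼_) (_≼?_ : Decidable _≼_) where

    maximal-above : ∀ c xs → ∃[ m ] m ∈ c ∷ xs × c ≼ m × Maximal _≼_ (c ∷ xs) m
    maximal-above c [] = c , here refl , ≼-refl , (λ _ → refl) ∷ []
    maximal-above c (y ∷ ys) with maximal-above c ys
    ... | m , m∈ , c≼m , c-max ∷ ys-max with m ≼? y
    ...   | no m⋠y = m , widen m∈ , c≼m , c-max ∷ (⊥-elim ∘ m⋠y) ∷ ys-max
      where
      widen : ∀ {m} → m ∈ c ∷ ys → m ∈ c ∷ y ∷ ys
      widen (here eq) = here eq
      widen (there m∈) = there (there m∈)
    ...   | yes m≼y =
      let m' , m'∈ , y≼m' , y∷ys-max = maximal-above y ys
          c≼m' = ≼-trans c≼m (≼-trans m≼y y≼m')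
      in m' , there m'∈ , c≼m' , (λ m'≼c → ≼-antisym c≼m' m'≼c) ∷ y∷ys-max

reflects-sound : ∀ {P : Set} {b} → Reflects P b → T b → P
reflects-sound (ofʸ p) _ = p

reflects-complete : ∀ {P : Set} {b} → Reflects P b → P → T b
reflects-complete (ofʸ _) _ = _
reflects-complete (ofⁿ ¬p) p = ¬p p

-- Intervals

-- The booleans of _≤-dec_, _∈ᵢ?_ and _⊆ᵢ?_ are, definitionally, _≤ᵇ_, _∈ᵇ_ and _⊆ᵇ_.
_≤-dec_ : (i j : ℤ) → Dec (i ≤ j)
i ≤-dec j = map′ ≤ᵇ⇒≤ ≤⇒≤ᵇ (T? (i ≤ᵇ j))

_∈ᵢ?_ : (x : ℤ) (I : Ival) → Dec (x ∈ᵢ I)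
x ∈ᵢ? (a , b) = (a ≤-dec x) ×-dec map′ ≰⇒> <⇒≱ (¬? (b ≤-dec x))

_⊆ᵢ?_ : (I J : Ival) → Dec (I ⊆ᵢ J)
(a , b) ⊆ᵢ? (c , d) = (c ≤-dec a) ×-dec (b ≤-dec d)

maximal? : (G : List Ival) (I : Ival) → Dec (Maximal _⊆ᵢ_ G I)
maximal? [] I = yes []
maximal? (J ∷ G) I =
  map′ (uncurry _∷_) (λ { (p ∷ ps) → p , ps })
       (((I ⊆ᵢ? J) →-dec ≡-dec _≟_ _≟_ J I) ×-dec maximal? G I)

∈ᵇ⇒∈ᵢ : ∀ {x} I → T (x ∈ᵇ I) → x ∈ᵢ I
∈ᵇ⇒∈ᵢ {x} I = reflects-sound (proof (x ∈ᵢ? I))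

∈ᵢ⇒∈ᵇ : ∀ {x} I → x ∈ᵢ I → T (x ∈ᵇ I)
∈ᵢ⇒∈ᵇ {x} I = reflects-complete (proof (x ∈ᵢ? I))

⊆ᵇ⇒⊆ᵢ : ∀ I {J} → T (I ⊆ᵇ J) → I ⊆ᵢ J
⊆ᵇ⇒⊆ᵢ I {J} = reflects-sound (proof (I ⊆ᵢ? J))

⊆ᵢ⇒⊆ᵇ : ∀ I {J} → I ⊆ᵢ J → T (I ⊆ᵇ J)
⊆ᵢ⇒⊆ᵇ I {J} = reflects-complete (proof (I ⊆ᵢ? J))

does-maximal? : ∀ G I → does (maximal? G I) ≡ isMaximalIn G I
does-maximal? [] I = refl
does-maximal? (J ∷ G) I =
  cong₂ (λ J≡I rest → (not (I ⊆ᵇ J) ∨ J≡I) ∧ rest)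
        (sym (isYes≗does (≡-dec _≟_ _≟_ J I))) (does-maximal? G I)

isMaximalIn⇒Maximal : ∀ G I → T (isMaximalIn G I) → Maximal _⊆ᵢ_ G I
isMaximalIn⇒Maximal G I t = reflects-sound (proof (maximal? G I)) (subst T (sym (does-maximal? G I)) t)

Maximal⇒isMaximalIn : ∀ G I → Maximal _⊆ᵢ_ G I → T (isMaximalIn G I)
Maximal⇒isMaximalIn G I m = subst T (does-maximal? G I) (reflects-complete (proof (maximal? G I)) m)

⊆ᵢ-refl : Reflexive _⊆ᵢ_
⊆ᵢ-refl = ≤-refl , ≤-refl

⊆ᵢ-trans : Transitive _⊆ᵢ_
⊆ᵢ-trans (c≤a , b≤d) (e≤c , d≤f) = ≤-trans e≤c c≤a , ≤-trans b≤d d≤f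

⊆ᵢ-antisym : Antisymmetric _≡_ _⊆ᵢ_
⊆ᵢ-antisym (c≤a , b≤d) (a≤c , d≤b) = cong₂ _,_ (≤-antisym a≤c c≤a) (≤-antisym b≤d d≤b)

∈-⊆ᵢ : ∀ {x I J} → I ⊆ᵢ J → x ∈ᵢ I → x ∈ᵢ J
∈-⊆ᵢ (c≤a , b≤d) (a≤x , x<b) = ≤-trans c≤a a≤x , <-≤-trans x<b b≤d

maximal-interval-above : ∀ c xs → ∃[ m ] m ∈ c ∷ xs × c ⊆ᵢ m × Maximal _⊆ᵢ_ (c ∷ xs) m
maximal-interval-above = maximal-above ⊆ᵢ-refl ⊆ᵢ-trans ⊆ᵢ-antisym _⊆ᵢ?_

maximal-antichain : ∀ {G y z} → y ∈ G → z ∈ G → Maximal _⊆ᵢ_ G y → Maximal _⊆ᵢ_ G z →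
                    y ≢ z → proj₁ y ≤ proj₁ z → proj₁ y < proj₁ z × proj₂ y < proj₂ z
maximal-antichain {y = a , b} {a' , b'} y∈ z∈ y-max z-max y≢z a≤a' = a<a' , b<b'
  where
  b<b' : b < b'
  b<b' with b' ≤? b
  ... | yes b'≤b = ⊥-elim (y≢z (All.lookup z-max y∈ (a≤a' , b'≤b)))
  ... | no b'≰b = ≰⇒> b'≰b
  a<a' : a < a'
  a<a' with a' ≤? a
  ... | yes a'≤a = ⊥-elim (y≢z (sym (All.lookup y-max z∈ (a'≤a , <⇒≤ b<b'))))
  ... | no a'≰a = ≰⇒> a'≰a

maximal-right-bound : ∀ {G y M} → Maximal _⊆ᵢ_ G y → M ∈ G → proj₁ M ≤ proj₁ y →
                      proj₂ M ≤ proj₂ y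
maximal-right-bound {y = y} {M} y-max M∈G M≤y with proj₂ y <? proj₂ M
... | yes b<M = ⊥-elim (<-irrefl (cong proj₂ (sym (All.lookup y-max M∈G (M≤y , <⇒≤ b<M)))) b<M)
... | no b≮M = ≮⇒≥ b≮M

-- Counting

N-∷ : ∀ x f F → N x (f ∷ F) ≡ Nᵢ x f + N x F
N-∷ x f F with x ∈ᵇ f
... | true = refl
... | false = refl

N-++ : ∀ x F G → N x (F ++ G) ≡ N x F + N x G
N-++ x F G = trans (cong length (filter-++ (T? ∘ (x ∈ᵇ_)) F G)) (length-++ (filterᵇ (x ∈ᵇ_) F))

N-↭ : ∀ x {F G} → F ↭ G → N x F ≡ N x G
N-↭ x F↭G = ↭-length (filter-↭ (T? ∘ (x ∈ᵇ_)) F↭G)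

N-∷-+ˡ : ∀ x f {K F} n → N x K + n ≡ N x F → N x (f ∷ K) + n ≡ N x (f ∷ F)
N-∷-+ˡ x f {K} {F} n eq = begin
  N x (f ∷ K) + n ≡⟨ cong (_+ n) (N-∷ x f K) ⟩
  Nᵢ x f + N x K + n ≡⟨ ℕ.+-assoc (Nᵢ x f) _ n ⟩
  Nᵢ x f + (N x K + n) ≡⟨ cong (Nᵢ x f +_) eq ⟩
  Nᵢ x f + N x F ≡⟨ N-∷ x f F ⟨
  N x (f ∷ F) ∎
  where open ≡-Reasoning

N-∷-+ʳ : ∀ x f {C F} m → m + N x C ≡ N x F → m + N x (f ∷ C) ≡ N x (f ∷ F)
N-∷-+ʳ x f {C} {F} m eq = begin
  m + N x (f ∷ C) ≡⟨ cong (m +_) (N-∷ x f C) ⟩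
  m + (Nᵢ x f + N x C) ≡⟨ x∙yz≈y∙xz m (Nᵢ x f) _ ⟩
  Nᵢ x f + (m + N x C) ≡⟨ cong (Nᵢ x f +_) eq ⟩
  Nᵢ x f + N x F ≡⟨ N-∷ x f F ⟨
  N x (f ∷ F) ∎
  where open ≡-Reasoning

N-partition : ∀ (p q : Ival → Bool) x F →
              N x (filterᵇ (λ f → not (p f ∧ q f)) F) + N x (filterᵇ p (filterᵇ q F)) ≡ N x F
N-partition p q x [] = refl
N-partition p q x (f ∷ F) with q f
... | false with p f
...   | true = N-∷-+ˡ x f _ (N-partition p q x F)
...   | false = N-∷-+ˡ x f _ (N-partition p q x F)
N-partition p q x (f ∷ F) | true with p f
...   | true = N-∷-+ʳ x f _ (N-partition p q x F)
...   | false = N-∷-+ˡ x f _ (N-partition p q x F)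

ray : ℤ → ℤ → ℕ
ray a x = if a ≤ᵇ x then 1 else 0

Nᵢ+ray : ∀ x {a b} → a ≤ b → Nᵢ x (a , b) + ray b x ≡ ray a x
Nᵢ+ray x {a} {b} a≤b = indicator (a ≤ᵇ x) (b ≤ᵇ x) (λ b≤x → ≤⇒≤ᵇ (≤-trans a≤b (≤ᵇ⇒≤ b≤x)))
  where
  indicator : ∀ p q → (T q → T p) →
              (if p ∧ not q then 1 else 0) + (if q then 1 else 0) ≡ (if p then 1 else 0)
  indicator true true _ = refl
  indicator true false _ = refl
  indicator false true q⇒p = ⊥-elim (q⇒p _)
  indicator false false _ = refl

-- Both sides equal ray a + ray a' − ray b − ray B.
Nᵢ-exchange : ∀ x {a a' b B} → a ≤ a' → a' ≤ b → b ≤ B →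
              Nᵢ x (a , b) + Nᵢ x (a' , B) ≡ Nᵢ x (a' , b) + Nᵢ x (a , B)
Nᵢ-exchange x {a} {a'} {b} {B} a≤a' a'≤b b≤B = ℕ.+-cancelʳ-≡ (ray b x + ray B x) _ _ (begin
  (Nᵢ x (a , b) + Nᵢ x (a' , B)) + (ray b x + ray B x)
    ≡⟨ interchange (Nᵢ x (a , b)) (Nᵢ x (a' , B)) (ray b x) (ray B x) ⟩
  (Nᵢ x (a , b) + ray b x) + (Nᵢ x (a' , B) + ray B x) ≡⟨ cong₂ _+_ (Nᵢ+ray x a≤b) (Nᵢ+ray x a'≤B) ⟩
  ray a x + ray a' x ≡⟨ ℕ.+-comm (ray a x) _ ⟩
  ray a' x + ray a x ≡⟨ cong₂ _+_ (Nᵢ+ray x a'≤b) (Nᵢ+ray x a≤B) ⟨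
  (Nᵢ x (a' , b) + ray b x) + (Nᵢ x (a , B) + ray B x)
    ≡⟨ interchange (Nᵢ x (a' , b)) (ray b x) (Nᵢ x (a , B)) (ray B x) ⟩
  (Nᵢ x (a' , b) + Nᵢ x (a , B)) + (ray b x + ray B x) ∎)
  where
  open ≡-Reasoning
  a≤b = ≤-trans a≤a' a'≤b
  a'≤B = ≤-trans a'≤b b≤B
  a≤B = ≤-trans a≤b b≤B

Nᵢ-cong : ∀ x {I J} → (x ∈ᵢ I → x ∈ᵢ J) → (x ∈ᵢ J → x ∈ᵢ I) → Nᵢ x I ≡ Nᵢ x J
Nᵢ-cong x {I} {J} I⇒J J⇒I =
  cong (λ b → if b then 1 else 0) (det (proof (x ∈ᵢ? I)) (proof (map′ J⇒I I⇒J (x ∈ᵢ? J))))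

Nᵢ-∉ : ∀ x {I} → ¬ x ∈ᵢ I → Nᵢ x I ≡ 0
Nᵢ-∉ x {I} x∉I = cong (λ b → if b then 1 else 0) (det (proof (x ∈ᵢ? I)) (ofⁿ x∉I))

N-restrict-mono : ∀ x {u v} F → (∀ {f} → f ∈ F → f ⊆ᵢ u → x ∈ᵢ f → f ⊆ᵢ v) →
                  N x (restrict F u) ≤ℕ N x (restrict F v)
N-restrict-mono x {u} {v} F h = length-filter-mono (x ∈ᵇ_) (_⊆ᵇ u) (_⊆ᵇ v) F
  (λ {f} f∈F f⊆u x∈f → ⊆ᵢ⇒⊆ᵇ f (h f∈F (⊆ᵇ⇒⊆ᵢ f f⊆u) (∈ᵇ⇒∈ᵢ f x∈f)))

2≤N-restrict : ∀ {x f g u F} → f ∈ F → g ∈ F → f ≢ g → f ⊆ᵢ u → g ⊆ᵢ u → x ∈ᵢ f → x ∈ᵢ g →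
               2 ≤ℕ N x (restrict F u)
2≤N-restrict {x} {u = u} f∈F g∈F f≢g f⊆u g⊆u x∈f x∈g =
  distinct∈⇒2≤length (through f∈F f⊆u x∈f) (through g∈F g⊆u x∈g) f≢g
  where
  through : ∀ {f F} → f ∈ F → f ⊆ᵢ u → x ∈ᵢ f → f ∈ filterᵇ (x ∈ᵇ_) (restrict F u)
  through {f} f∈F f⊆u x∈f =
    ∈-filter⁺ (T? ∘ (x ∈ᵇ_)) (∈-filter⁺ (T? ∘ (_⊆ᵇ u)) f∈F (⊆ᵢ⇒⊆ᵇ f f⊆u)) (∈ᵢ⇒∈ᵇ f x∈f)

_≤ₗ_ : Ival → Ival → Set
I ≤ₗ J = proj₁ I ≤ proj₁ J

insertByLeft-↭ : ∀ I l → insertByLeft I l ↭ I ∷ l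
insertByLeft-↭ I [] = ↭-refl
insertByLeft-↭ I (J ∷ l) with proj₁ I ≤ᵇ proj₁ J
... | true = ↭-refl
... | false = ↭-trans (prep J (insertByLeft-↭ I l)) (swap J I ↭-refl)

sortByLeft-↭ : ∀ l → sortByLeft l ↭ l
sortByLeft-↭ [] = ↭-refl
sortByLeft-↭ (I ∷ l) = ↭-trans (insertByLeft-↭ I (sortByLeft l)) (prep I (sortByLeft-↭ l))

insertByLeft-sorted : ∀ I {l} → AllPairs _≤ₗ_ l → AllPairs _≤ₗ_ (insertByLeft I l)
insertByLeft-sorted I [] = [] ∷ []
insertByLeft-sorted I {J ∷ l} (J≤l ∷ sorted) with proj₁ I ≤ᵇ proj₁ J in I≤ᵇJ
... | true = (I≤J ∷ All.map (≤-trans I≤J) J≤l) ∷ J≤l ∷ sorted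
  where I≤J = ≤ᵇ⇒≤ (subst T (sym I≤ᵇJ) _)
... | false = All-resp-↭ (↭-sym (insertByLeft-↭ I l)) (J≤I ∷ J≤l) ∷ insertByLeft-sorted I sorted
  where J≤I = <⇒≤ (≰⇒> (λ I≤J → subst T I≤ᵇJ (≤⇒≤ᵇ I≤J)))

sortByLeft-sorted : ∀ l → AllPairs _≤ₗ_ (sortByLeft l)
sortByLeft-sorted [] = []
sortByLeft-sorted (I ∷ l) = insertByLeft-sorted I (sortByLeft-sorted l)

-- Staircases

_≺_ : Ival → Ival → Set
(a , b) ≺ (a' , b') = a < a' × b < b' × a' < b

overlapOf : Ival → Ival → Ival
overlapOf (a , b) (a' , b') = a' , b

overlaps : List Ival → List Ival
overlaps l = zipWith overlapOf l (drop 1 l)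

lastRight : Ival → List Ival → ℤ
lastRight y [] = proj₂ y
lastRight y (z ∷ l) = lastRight z l

span : Ival → List Ival → Ival
span y l = proj₁ y , lastRight y l

⊆-span : ∀ {y l} → Linked _≺_ (y ∷ l) → All (_⊆ᵢ span y l) (y ∷ l)
⊆-span [-] = ⊆ᵢ-refl ∷ []
⊆-span ((a<a' , b<b' , _) ∷ stairs) with ⊆-span stairs
... | z⊆ ∷ rest⊆ = (≤-refl , ≤-trans (<⇒≤ b<b') (proj₂ z⊆))
                   ∷ All.map (λ (p , q) → ≤-trans (<⇒≤ a<a') p , q) (z⊆ ∷ rest⊆)

span-⊆ : ∀ {s y l} → All (_⊆ᵢ s) (y ∷ l) → span y l ⊆ᵢ s
span-⊆ (y⊆s ∷ []) = y⊆s
span-⊆ (y⊆s ∷ rest@(_ ∷ _)) = proj₁ y⊆s , proj₂ (span-⊆ rest)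

N-staircase : ∀ x {y l} → Linked _≺_ (y ∷ l) →
              N x (y ∷ l) ≡ N x (overlaps (y ∷ l)) + Nᵢ x (span y l)
N-staircase x {y} [-] = trans (N-∷ x y []) (ℕ.+-identityʳ (Nᵢ x y))
N-staircase x {y@(a , b)} {z@(a' , b') ∷ l} stairs@((a<a' , b<b' , a'<b) ∷ rest) = begin
  N x (y ∷ z ∷ l) ≡⟨ N-∷ x y (z ∷ l) ⟩
  Nᵢ x y + N x (z ∷ l) ≡⟨ cong (Nᵢ x y +_) (N-staircase x rest) ⟩
  Nᵢ x y + (n + Nᵢ x (a' , B)) ≡⟨ x∙yz≈y∙xz (Nᵢ x y) n _ ⟩
  n + (Nᵢ x y + Nᵢ x (a' , B)) ≡⟨ cong (n +_) (Nᵢ-exchange x (<⇒≤ a<a') (<⇒≤ a'<b) b≤B) ⟩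
  n + (Nᵢ x (a' , b) + Nᵢ x (a , B)) ≡⟨ x∙yz≈y∙xz n (Nᵢ x (a' , b)) (Nᵢ x (a , B)) ⟩
  Nᵢ x (a' , b) + (n + Nᵢ x (a , B)) ≡⟨ ℕ.+-assoc (Nᵢ x (a' , b)) n _ ⟨
  Nᵢ x (a' , b) + n + Nᵢ x (a , B) ≡⟨ cong (_+ Nᵢ x (a , B)) (N-∷ x (a' , b) (overlaps (z ∷ l))) ⟨
  N x (overlaps (y ∷ z ∷ l)) + Nᵢ x (span y (z ∷ l)) ∎
  where
  open ≡-Reasoning
  n = N x (overlaps (z ∷ l))
  B = lastRight z l
  b≤B = proj₂ (All.lookup (⊆-span stairs) (here refl))

N-cover : ∀ x {s l} → Linked _≺_ l → All (_⊆ᵢ s) l → (x ∈ᵢ s → Any (x ∈ᵢ_) l) →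
          N x l ≡ N x (overlaps l) + Nᵢ x s
N-cover x [] _ covers = sym (Nᵢ-∉ x (¬Any[] ∘ covers))
N-cover x {s} {y ∷ l} stairs l⊆s covers =
  trans (N-staircase x stairs) (cong (N x (overlaps (y ∷ l)) +_) (Nᵢ-cong x span⇒s s⇒span))
  where
  span⇒s : x ∈ᵢ span y l → x ∈ᵢ s
  span⇒s = ∈-⊆ᵢ (span-⊆ l⊆s)
  s⇒span : x ∈ᵢ s → x ∈ᵢ span y l
  s⇒span x∈s = All.lookupWith ∈-⊆ᵢ (⊆-span stairs) (covers x∈s)

overlaps-right-of : ∀ {y l} → Linked _≺_ (y ∷ l) →
                    All (λ g → proj₁ y < proj₁ g) (overlaps (y ∷ l))
overlaps-right-of [-] = []
overlaps-right-of ((a<a' , _) ∷ rest) = a<a' ∷ All.map (<-trans a<a') (overlaps-right-of rest)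

overlaps-unique : ∀ {l} → Linked _≺_ l → Unique (overlaps l)
overlaps-unique [] = []
overlaps-unique [-] = []
overlaps-unique (_ ∷ rest) =
  All.map (λ a'<g eq → <-irrefl (cong proj₁ eq) a'<g) (overlaps-right-of rest) ∷ overlaps-unique rest

-- Minimal bad intervals

module MinimalBadInterval (F : List Ival) (fam : IsFamily F) (s : Ival) (mb : MinimalBad F s) where

  R : List Ival
  R = restrict F s

  ms : List Ival
  ms = maxList F s

  ∈R⁺ : ∀ {f} → f ∈ F → f ⊆ᵢ s → f ∈ R
  ∈R⁺ {f} f∈F f⊆s = ∈-filter⁺ (T? ∘ (_⊆ᵇ s)) f∈F (⊆ᵢ⇒⊆ᵇ f f⊆s)

  ∈R⁻ : ∀ {f} → f ∈ R → f ∈ F × f ⊆ᵢ s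
  ∈R⁻ {f} f∈R = let f∈F , f⊆s = ∈-filter⁻ (T? ∘ (_⊆ᵇ s)) f∈R in f∈F , ⊆ᵇ⇒⊆ᵢ f f⊆s

  ms↭ : ms ↭ maximals R
  ms↭ = sortByLeft-↭ (maximals R)

  ∈ms⁺ : ∀ {M} → M ∈ R → Maximal _⊆ᵢ_ R M → M ∈ ms
  ∈ms⁺ {M} M∈R M-max =
    ∈-resp-↭ (↭-sym ms↭) (∈-filter⁺ (T? ∘ isMaximalIn R) M∈R (Maximal⇒isMaximalIn R M M-max))

  ∈ms⁻ : ∀ {M} → M ∈ ms → M ∈ R × Maximal _⊆ᵢ_ R M
  ∈ms⁻ {M} M∈ms =
    let M∈R , M-max = ∈-filter⁻ (T? ∘ isMaximalIn R) (∈-resp-↭ ms↭ M∈ms)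
    in M∈R , isMaximalIn⇒Maximal R M M-max

  ms⊆s : All (_⊆ᵢ s) ms
  ms⊆s = All.tabulate (proj₂ ∘ ∈R⁻ ∘ proj₁ ∘ ∈ms⁻)

  ms-sorted : AllPairs _≤ₗ_ ms
  ms-sorted = sortByLeft-sorted (maximals R)

  ms-unique : Unique ms
  ms-unique = Unique-resp-↭ (↭-sym ms↭) (Unique.filter⁺ _ (Unique.filter⁺ _ (proj₂ fam)))

  maximal-cover : ∀ {f} → f ∈ R → ∃[ M ] M ∈ ms × f ⊆ᵢ M
  maximal-cover {f} f∈R with maximal-interval-above f R
  ... | M , here refl , _ , _ ∷ M-max = M , ∈ms⁺ f∈R M-max , ⊆ᵢ-refl
  ... | M , there M∈R , f⊆M , _ ∷ M-max = M , ∈ms⁺ M∈R M-max , f⊆M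

  2≤N : ∀ {x} → x ∈ᵢ s → 2 ≤ℕ N x R
  2≤N x∈s = ℕ.≰⇒> (λ N≤1 → proj₁ (proj₂ mb) (_ , x∈s , N≤1))

  ms-cover : ∀ {x} → x ∈ᵢ s → Any (x ∈ᵢ_) ms
  ms-cover {x} x∈s =
    let f , f∈ = nonempty⇒∈ (ℕ.≤-trans (s≤s z≤n) (2≤N x∈s))
        f∈R , x∈f = ∈-filter⁻ (T? ∘ (x ∈ᵇ_)) f∈
        M , M∈ms , f⊆M = maximal-cover f∈R
    in lose M∈ms (∈-⊆ᵢ f⊆M (∈ᵇ⇒∈ᵢ f x∈f))

  left-of-adjacent⇒⊆prefix : ∀ {y z f x} → Adjacent _≤ₗ_ ms y z → Maximal _⊆ᵢ_ R y →
                             f ∈ R → x ∈ᵢ f → x < proj₁ z → f ⊆ᵢ (proj₁ s , proj₂ y)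
  left-of-adjacent⇒⊆prefix (_ , _ , gaps) y-max f∈R x∈f x<a' with maximal-cover f∈R
  ... | M , M∈ms , f⊆M with All.lookup gaps M∈ms
  ...   | inj₁ M≤y = proj₁ (proj₂ (∈R⁻ f∈R))
                   , ≤-trans (proj₂ f⊆M) (maximal-right-bound y-max (proj₁ (∈ms⁻ M∈ms)) M≤y)
  ...   | inj₂ z≤M = ⊥-elim (<⇒≱ x<a' (≤-trans z≤M (≤-trans (proj₁ f⊆M) (proj₁ x∈f))))

  -- The prefix t = [min s, b) of s is proper, hence not bad; left of a' it agrees with s,
  -- so it can only be good at a point of [a', b).
  prefix-good-right-of : ∀ {y z} → Adjacent _≤ₗ_ ms y z → proj₂ y < proj₂ s →
                         ¬ (∀ {x} → x ∈ᵢ (proj₁ s , proj₂ y) → proj₁ z ≤ x →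
                              2 ≤ℕ N x (restrict F (proj₁ s , proj₂ y)))
  prefix-good-right-of {_ , b} {a' , _} adj@(y∈ms , _ , _) b<max-s right-of-a' =
    proj₂ (proj₂ mb) t t-interval t⊆s (λ t≡s → <-irrefl (cong proj₂ t≡s) b<max-s) t-bad
    where
    y∈R = proj₁ (∈ms⁻ y∈ms)
    y⊆s = proj₂ (∈R⁻ y∈R)
    t : Ival
    t = proj₁ s , b
    t-interval : IsInterval t
    t-interval = ≤-<-trans (proj₁ y⊆s) (All.lookup (proj₁ fam) (proj₁ (∈R⁻ y∈R)))
    t⊆s : t ⊆ᵢ s
    t⊆s = ≤-refl , <⇒≤ b<max-s
    t-bad : Bad F t
    t-bad (x , x∈t , N≤1) with x <? a'
    ... | no x≮a' = ℕ.<⇒≱ (right-of-a' x∈t (≮⇒≥ x≮a')) N≤1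
    ... | yes x<a' = ℕ.<⇒≱ (ℕ.≤-trans (2≤N (∈-⊆ᵢ t⊆s x∈t)) (N-restrict-mono x F inside-t)) N≤1
      where
      inside-t : ∀ {f} → f ∈ F → f ⊆ᵢ s → x ∈ᵢ f → f ⊆ᵢ t
      inside-t f∈F f⊆s x∈f =
        left-of-adjacent⇒⊆prefix adj (proj₂ (∈ms⁻ y∈ms)) (∈R⁺ f∈F f⊆s) x∈f x<a'

  adjacent-maximals : ∀ {y z} → Adjacent _≤ₗ_ ms y z → y ≢ z → y ≤ₗ z →
                      y ≺ z × overlapOf y z ∉ F
  adjacent-maximals {a , b} {a' , b'} adj@(y∈ms , z∈ms , _) y≢z a≤a' =
    (a<a' , b<b' , a'<b) , overlap∉F
    where
    y∈R = proj₁ (∈ms⁻ y∈ms)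
    z∈R = proj₁ (∈ms⁻ z∈ms)
    y∈F = proj₁ (∈R⁻ y∈R)
    y⊆s = proj₂ (∈R⁻ y∈R)
    a<a'×b<b' = maximal-antichain y∈R z∈R (proj₂ (∈ms⁻ y∈ms)) (proj₂ (∈ms⁻ z∈ms)) y≢z a≤a'
    a<a' = proj₁ a<a'×b<b'
    b<b' = proj₂ a<a'×b<b'
    no-witness = prefix-good-right-of adj (<-≤-trans b<b' (proj₂ (proj₂ (∈R⁻ z∈R))))

    a'<b : a' < b
    a'<b with a' <? b
    ... | yes a'<b = a'<b
    ... | no a'≮b = ⊥-elim (no-witness (λ x∈t a'≤x → ⊥-elim (a'≮b (≤-<-trans a'≤x (proj₂ x∈t)))))

    overlap∉F : (a' , b) ∉ F
    overlap∉F overlap∈F = no-witness (λ {x} (_ , x<b) a'≤x →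
      2≤N-restrict y∈F overlap∈F (λ y≡ → <-irrefl (cong proj₁ y≡) a<a')
                   (proj₁ y⊆s , ≤-refl) (≤-trans (proj₁ y⊆s) (<⇒≤ a<a') , ≤-refl)
                   (<⇒≤ (<-≤-trans a<a' a'≤x) , x<b) (a'≤x , x<b))

  ms-staircase : Linked (λ y z → y ≺ z × overlapOf y z ∉ F) ms
  ms-staircase = Linked.map (λ ((adj , y≢z) , y≤z) → adjacent-maximals adj y≢z y≤z)
    (Linked.zip (Linked.zip (AllPairs⇒Linked-adjacent ≤-refl ms-sorted , AllPairs⇒Linked ms-unique)
                , AllPairs⇒Linked ms-sorted))

  overlapping : Overlapping F s
  overlapping = Linked⇒All-zipWith _,_ (Linked.map (proj₂ ∘ proj₂ ∘ proj₁) ms-staircase)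

  kept : List Ival
  kept = filterᵇ (λ f → not (isMaximalIn R f ∧ (f ⊆ᵇ s))) F

  kept++overlaps-unique : Unique (kept ++ overlaps ms)
  kept++overlaps-unique =
    Unique.++⁺ (Unique.filter⁺ _ (proj₂ fam)) (overlaps-unique (Linked.map proj₁ ms-staircase))
      (λ (g∈kept , g∈overlaps) →
        All.lookup (Linked⇒All-zipWith overlapOf (Linked.map proj₂ ms-staircase)) g∈overlaps
                   (proj₁ (∈-filter⁻ _ g∈kept)))

  N-↓ : ∀ x → N x (F ↓ s) + Nᵢ x s ≡ N x F
  N-↓ x = begin
    N x (F ↓ s) + Nᵢ x s
      ≡⟨ cong (λ L → N x L + Nᵢ x s) (deduplicate-unique (≡-dec _≟_ _≟_) kept++overlaps-unique) ⟩
    N x (kept ++ overlaps ms) + Nᵢ x s ≡⟨ cong (_+ Nᵢ x s) (N-++ x kept (overlaps ms)) ⟩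
    N x kept + N x (overlaps ms) + Nᵢ x s ≡⟨ ℕ.+-assoc (N x kept) _ _ ⟩
    N x kept + (N x (overlaps ms) + Nᵢ x s)
      ≡⟨ cong (N x kept +_) (N-cover x (Linked.map proj₁ ms-staircase) ms⊆s ms-cover) ⟨
    N x kept + N x ms ≡⟨ cong (N x kept +_) (N-↭ x ms↭) ⟩
    N x kept + N x (maximals R) ≡⟨ N-partition (isMaximalIn R) (_⊆ᵇ s) x F ⟩
    N x F ∎
    where open ≡-Reasoning

mainTheorem6 : (F : List Ival) → IsFamily F → (s : Ival) → MinimalBad F s →
    Overlapping F s × (∀ (x : ℤ) → N x (F ↓ s) + Nᵢ x s ≡ N x F)
mainTheorem6 F fam s mb = overlapping , N-↓
  where open MinimalBadInterval F fam s mb
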